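{- For any loopless digraph $D$ without in-universal vertices, \[ \frac{1}{\gamma^{in}_f(D)} + \frac{1}{\Gamma^{out}_f(\overline{D})} = 1. \]
   Context: A loopless digraph $D$ has a finite vertex set $V(D)$ and arc set $E(D) \subseteq V(D)^2 \setminus \{(v,v)\}$. Its complement $\overline{D}$ has vertex set $V(D)$ and arc set $V(D)^2 \setminus (\{(v,v): v\in V(D)\} \cup E(D))$. For $v\in V(D)$: the open in-neighbourhood is $N^{in}_o(v) = \{u : (u,v)\in E(D)\}$, the closed in-neighbourhood is $N^{in}_c(v) = N^{in}_o(v)\cup\{v\}$, the open out-neighbourhood is $N^{out}_o(v) = \{u : (v,u) \in E(D)\}$. For a hypergraph $H=(V,E)$ (finite vertex set, multiset of edges), the fractional transversal number $\tau_f(H)$ is the optimal value of $\min\sum_{v} x_v$ s.t. $\sum_{v \in e} x_v \ge 1$ for all $e\in E$, $x\ge 0$. The fractional in-dominating number is $\gamma^{in}_f(D) = \tau_f(H)$ where $H$ has vertex set $V(D)$ and edges the closed in-neighbourhoods $N^{in}_c(v)$, $v \in V(D)$. The fractional total out-dominating number is $\Gamma^{out}_f(D) = \tau_f(H')$ where $H'$ has vertex set $V(D)$ and edges the open out-neighbourhoods $N^{out}_o(v)$, $v\in V(D)$. A vertex $v$ is in-universal in $D$ if $v \in N^{in}_c(u)$ for all $u\in V(D)$. -}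

module Defs where

open import Data.Nat using (ℕ; zero; suc)
open import Data.Fin using (Fin; _≟_)
import Data.Fin as F
open import Data.Bool using (Bool; true; false; not; _∧_; _∨_; if_then_else_)
open import Data.Rational using (ℚ; 0ℚ; 1ℚ; _+_; _≤_)
open import Data.Product using (Σ; _×_; ∃)
open import Relation.Nullary using (¬_)
open import Relation.Nullary.Decidable using (⌊_⌋)
open import Relation.Binary.PropositionalEquality using (_≡_)

record Digraph : Set where
  field
    n   : ℕ
    arc : Fin n → Fin n → Bool
open Digraph public

Loopless : Digraph → Set
Loopless D = ∀ v → arc D v v ≡ false

complement : Digraph → Digraph
complement D = record
  { n = n D
  ; arc = λ u v → not (arc D u v) ∧ not ⌊ u ≟ v ⌋ }

-- A hypergraph on vertex set Fin n with a family (multiset) of m edges;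
-- edge j v = true iff v ∈ e_j.
record Hypergraph (n : ℕ) : Set where
  field
    m    : ℕ
    edge : Fin m → Fin n → Bool
open Hypergraph public

sumFin : ∀ {k} → (Fin k → ℚ) → ℚ
sumFin {zero}  f = 0ℚ
sumFin {suc k} f = f F.zero + sumFin (λ i → f (F.suc i))

sumOver : ∀ {k} → (Fin k → Bool) → (Fin k → ℚ) → ℚ
sumOver e x = sumFin (λ v → if e v then x v else 0ℚ)

FracTransversal : ∀ {k} → Hypergraph k → (Fin k → ℚ) → Set
FracTransversal H x = (∀ v → 0ℚ ≤ x v) × (∀ j → 1ℚ ≤ sumOver (edge H j) x)

IsTauF : ∀ {k} → Hypergraph k → ℚ → Set
IsTauF H t =
  (Σ _ λ x → FracTransversal H x × sumFin x ≡ t)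
  × (∀ x → FracTransversal H x → t ≤ sumFin x)

-- closed in-neighbourhood of v: u ∈ N^in_c(v) iff (u,v) ∈ E or u = v
inClosed : (D : Digraph) → Fin (n D) → Fin (n D) → Bool
inClosed D v u = arc D u v ∨ ⌊ u ≟ v ⌋

outOpen : (D : Digraph) → Fin (n D) → Fin (n D) → Bool
outOpen D v u = arc D v u

inHypergraph : (D : Digraph) → Hypergraph (n D)
inHypergraph D = record { m = n D ; edge = inClosed D }

outHypergraph : (D : Digraph) → Hypergraph (n D)
outHypergraph D = record { m = n D ; edge = outOpen D }

IsFracInDom : Digraph → ℚ → Set
IsFracInDom D t = IsTauF (inHypergraph D) t

IsFracTotalOutDom : Digraph → ℚ → Set
IsFracTotalOutDom D t = IsTauF (outHypergraph D) t

InUniversal : (D : Digraph) → Fin (n D) → Set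
InUniversal D v = ∀ u → inClosed D u v ≡ true

module Submission where

-- Let A v u = true iff u ∈ N^in_c(v). Then γ^in_f(D) is the value t of the covering program
-- min Σ x subject to A x ≥ 1, x ≥ 0, while the out-hypergraph of the complement has the edges
-- V ∖ N^out_c(v), the complements of the columns of A. By strong duality there is a packing z ≥ 0,
-- z A ≤ 1, with Σ z = t; then z / (t - 1) covers those complements with weight t / (t - 1), and
-- weak duality against an optimal x shows that nothing cheaper does, so Γ^out_f = t / (t - 1).
-- Here t > 1 because a cover of weight 1 is carried by vertices in every N^in_c(v), which are
-- in-universal. Strong duality is derived from Farkas' lemma, proved by Fourier–Motzkin elimination.

open import Defs
open import Data.Nat using (NonZero)
open import Data.Fin using (Fin)
open import Data.Rational using (ℚ; 0ℚ; 1ℚ; _+_; _<_; 1/_; >-nonZero)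
open import Data.Product using (Σ; _×_; ∃₂)
open import Relation.Nullary using (¬_)
open import Relation.Binary.PropositionalEquality using (_≡_)

open import Algebra.Bundles using (Ring)
open import Data.Bool using (Bool; true; false; not; _∧_; _∨_; if_then_else_)
open import Data.Bool.Properties using (∨-zeroʳ)
open import Data.Empty using (⊥-elim)
open import Data.Fin using (zero; suc; _↑ˡ_; _↑ʳ_; splitAt; _≟_)
open import Data.Fin.Properties using (join-splitAt)
open import Data.List using (List; []; _∷_; map; cartesianProductWith; tabulate) renaming (_++_ to _++ₗ_)
open import Data.List.Relation.Unary.All as All using (All; []; _∷_)
import Data.List.Relation.Unary.All.Properties as All
open import Data.Nat using (ℕ)
import Data.Nat as ℕ
open import Data.Product using (_,_; ∃; proj₁; proj₂)
open import Data.Rational using (_≤_; _*_; -_; _-_; _<?_; positive; nonNegative)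
open import Data.Rational.Properties hiding (_≟_)
open import Data.Rational.Solver using (module +-*-Solver)
open import Data.Sum using (_⊎_; inj₁; inj₂)
open import Data.Sum.Properties using ([,]-∘)
open import Data.Vec.Functional using (Vector; replicate) renaming (_∷_ to _◂_; _++_ to _++ᵥ_)
open import Data.Vec.Functional.Properties using (lookup-++ˡ; lookup-++ʳ)
open import Function using (_∘_; const)
open import Relation.Binary.Bundles using (DecTotalOrder)
open import Relation.Binary.Definitions using (tri<; tri≈; tri>)
open import Relation.Binary.PropositionalEquality
  using (refl; sym; trans; cong; cong₂; subst; subst₂; _≗_; module ≡-Reasoning)
open import Relation.Nullary using (yes; no)
open import Relation.Nullary.Decidable using (⌊_⌋; isYes≗does; dec-true)

open import Algebra.Properties.Ring +-*-ring using (-‿involutive)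
open import Algebra.Properties.Semiring.Sum (Ring.semiring +-*-ring)
  using (sum; sum-cong-≗; ∑-distrib-+; ∑-comm; *-distribˡ-sum; *-distribʳ-sum; sum-replicate-zero)
open import Data.List.Extrema (DecTotalOrder.totalOrder ≤-decTotalOrder) using (min; max; min≤xs; xs≤max; v≤min⁺)

open +-*-Solver

0≤1 : 0ℚ ≤ 1ℚ
0≤1 = nonNegative⁻¹ 1ℚ

0≤p⇒0≤q⇒0≤p*q : ∀ {p q} → 0ℚ ≤ p → 0ℚ ≤ q → 0ℚ ≤ p * q
0≤p⇒0≤q⇒0≤p*q {p} {q} 0≤p 0≤q =
  nonNegative⁻¹ (p * q) {{nonNeg*nonNeg⇒nonNeg p {{nonNegative 0≤p}} q {{nonNegative 0≤q}}}}

*-monoˡ-≤-0≤ : ∀ {r p q} → 0ℚ ≤ r → p ≤ q → r * p ≤ r * q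
*-monoˡ-≤-0≤ {r} 0≤r = *-monoˡ-≤-nonNeg r {{nonNegative 0≤r}}

*-monoʳ-≤-0≤ : ∀ {r p q} → 0ℚ ≤ r → p ≤ q → p * r ≤ q * r
*-monoʳ-≤-0≤ {r} 0≤r = *-monoʳ-≤-nonNeg r {{nonNegative 0≤r}}

p≤q⇒0≤q-p : ∀ {p q} → p ≤ q → 0ℚ ≤ q - p
p≤q⇒0≤q-p {p} {q} p≤q = subst (_≤ q - p) (+-inverseʳ p) (+-monoˡ-≤ (- p) p≤q)

0≤q-p⇒p≤q : ∀ {p q} → 0ℚ ≤ q - p → p ≤ q
0≤q-p⇒p≤q {p} {q} 0≤q-p =
  subst₂ _≤_ (+-identityˡ p) (solve 2 (λ p q → (q :- p) :+ p := q) refl p q) (+-monoˡ-≤ p 0≤q-p)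

≤-resp-slack : ∀ {p q p′ q′} → q - p ≡ q′ - p′ → p ≤ q → p′ ≤ q′
≤-resp-slack q-p≡q′-p′ p≤q = 0≤q-p⇒p≤q (subst (0ℚ ≤_) q-p≡q′-p′ (p≤q⇒0≤q-p p≤q))

p<q⇒0<q-p : ∀ {p q} → p < q → 0ℚ < q - p
p<q⇒0<q-p {p} {q} p<q = subst (_< q - p) (+-inverseʳ p) (+-monoˡ-< (- p) p<q)

1/-unique : ∀ p q .{{_ : Data.Rational.NonZero p}} → p * q ≡ 1ℚ → 1/ p ≡ q
1/-unique p q pq≡1 = begin
  1/ p                ≡⟨ *-identityʳ (1/ p) ⟨
  1/ p * 1ℚ           ≡⟨ cong (1/ p *_) pq≡1 ⟨
  1/ p * (p * q)      ≡⟨ *-assoc (1/ p) p q ⟨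
  1/ p * p * q        ≡⟨ cong (_* q) (*-inverseˡ p) ⟩
  1ℚ * q              ≡⟨ *-identityˡ q ⟩
  q                   ∎
  where open ≡-Reasoning

sumFin≡sum : ∀ {k} (f : Vector ℚ k) → sumFin f ≡ sum f
sumFin≡sum {ℕ.zero}  f = refl
sumFin≡sum {ℕ.suc k} f = cong (f zero +_) (sumFin≡sum (f ∘ suc))

sum-mono-≤ : ∀ {k} {f g : Vector ℚ k} → (∀ i → f i ≤ g i) → sum f ≤ sum g
sum-mono-≤ {ℕ.zero}  f≤g = ≤-refl
sum-mono-≤ {ℕ.suc k} f≤g = +-mono-≤ (f≤g zero) (sum-mono-≤ (f≤g ∘ suc))

sum-nonNeg : ∀ {k} {f : Vector ℚ k} → (∀ i → 0ℚ ≤ f i) → 0ℚ ≤ sum f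
sum-nonNeg {k} {f} 0≤f = subst (_≤ sum f) (sum-replicate-zero k) (sum-mono-≤ 0≤f)

term≤sum : ∀ {k} {f : Vector ℚ k} → (∀ i → 0ℚ ≤ f i) → ∀ i → f i ≤ sum f
term≤sum {ℕ.suc k} {f} 0≤f zero =
  subst (_≤ sum f) (+-identityʳ (f zero)) (+-monoʳ-≤ (f zero) (sum-nonNeg (0≤f ∘ suc)))
term≤sum {ℕ.suc k} {f} 0≤f (suc i) =
  subst (_≤ sum f) (+-identityˡ (f (suc i))) (+-mono-≤ (0≤f zero) (term≤sum (0≤f ∘ suc) i))

0<sum⇒∃0<term : ∀ {k} (f : Vector ℚ k) → 0ℚ < sum f → ∃ λ i → 0ℚ < f i
0<sum⇒∃0<term {ℕ.zero}  f 0<0 = ⊥-elim (<-irrefl refl 0<0)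
0<sum⇒∃0<term {ℕ.suc k} f 0<sum with 0ℚ <? f zero
... | yes 0<f₀ = zero , 0<f₀
... | no  0≮f₀ with 0ℚ <? sum (f ∘ suc)
...   | yes 0<rest = let i , 0<fᵢ = 0<sum⇒∃0<term (f ∘ suc) 0<rest in suc i , 0<fᵢ
...   | no  0≮rest = ⊥-elim (<-irrefl refl (<-≤-trans 0<sum
          (subst (sum f ≤_) (+-identityˡ 0ℚ) (+-mono-≤ (≮⇒≥ 0≮f₀) (≮⇒≥ 0≮rest)))))

sum-++ : ∀ m {k} (f : Vector ℚ (m ℕ.+ k)) → sum f ≡ sum (f ∘ (_↑ˡ k)) + sum (f ∘ (m ↑ʳ_))
sum-++ ℕ.zero    f = sym (+-identityˡ (sum f))
sum-++ (ℕ.suc m) f = trans (cong (f zero +_) (sum-++ m (f ∘ suc))) (sym (+-assoc (f zero) _ _))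

_·_ : ∀ {k} → Vector ℚ k → Vector ℚ k → ℚ
a · x = sum (λ i → a i * x i)

δ : ∀ {k} → Fin k → Fin k → ℚ
δ i j = if ⌊ i ≟ j ⌋ then 1ℚ else 0ℚ

δ-nonNeg : ∀ {k} (i j : Fin k) → 0ℚ ≤ δ i j
δ-nonNeg i j with i ≟ j
... | yes _ = 0≤1
... | no  _ = ≤-refl

δ-comm : ∀ {k} (i j : Fin k) → δ i j ≡ δ j i
δ-comm i j with i ≟ j | j ≟ i
... | yes _   | yes _   = refl
... | no  _   | no  _   = refl
... | yes i≡j | no  j≢i = ⊥-elim (j≢i (sym i≡j))
... | no  i≢j | yes j≡i = ⊥-elim (i≢j (sym j≡i))

δ·x≡x : ∀ {k} (i : Fin k) (f : Vector ℚ k) → δ i · f ≡ f i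
δ·x≡x {ℕ.suc k} zero f = begin
  1ℚ * f zero + sum (λ j → 0ℚ * f (suc j)) ≡⟨ cong₂ _+_ (*-identityˡ (f zero))
                                                         (sum-cong-≗ (*-zeroˡ ∘ f ∘ suc)) ⟩
  f zero + sum {k} (const 0ℚ)              ≡⟨ cong (f zero +_) (sum-replicate-zero k) ⟩
  f zero + 0ℚ                              ≡⟨ +-identityʳ (f zero) ⟩
  f zero                                   ∎
  where open ≡-Reasoning
δ·x≡x {ℕ.suc k} (suc i) f = begin
  0ℚ * f zero + sum (λ j → δ (suc i) (suc j) * f (suc j)) ≡⟨ cong₂ _+_ (*-zeroˡ (f zero)) (sum-cong-≗ δ-suc) ⟩
  0ℚ + sum (λ j → δ i j * f (suc j))                      ≡⟨ +-identityˡ _ ⟩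
  sum (λ j → δ i j * f (suc j))                           ≡⟨ δ·x≡x i (f ∘ suc) ⟩
  f (suc i)                                               ∎
  where
  open ≡-Reasoning
  δ-suc : ∀ j → δ (suc i) (suc j) * f (suc j) ≡ δ i j * f (suc j)
  δ-suc j with i ≟ j
  ... | yes _ = refl
  ... | no  _ = refl

·-cong : ∀ {k} {a b : Vector ℚ k} (x : Vector ℚ k) → a ≗ b → a · x ≡ b · x
·-cong x a≗b = sum-cong-≗ (λ i → cong (_* x i) (a≗b i))

·-distribʳ-+ : ∀ {k} (a b x : Vector ℚ k) → (λ i → a i + b i) · x ≡ a · x + b · x
·-distribʳ-+ a b x = trans (sum-cong-≗ (λ i → *-distribʳ-+ (x i) (a i) (b i)))
                           (∑-distrib-+ (λ i → a i * x i) (λ i → b i * x i))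

·-assoc-* : ∀ {k} c (a x : Vector ℚ k) → (λ i → c * a i) · x ≡ c * (a · x)
·-assoc-* c a x = trans (sum-cong-≗ (λ i → *-assoc c (a i) (x i))) (sym (*-distribˡ-sum c (λ i → a i * x i)))

·-const : ∀ {k} c (x : Vector ℚ k) → const c · x ≡ c * sum x
·-const c x = sym (*-distribˡ-sum c x)

·-zeroˡ : ∀ {k} (x : Vector ℚ k) → const 0ℚ · x ≡ 0ℚ
·-zeroˡ {k} x = trans (sum-cong-≗ (*-zeroˡ ∘ x)) (sum-replicate-zero k)

·-zeroʳ : ∀ {k} (x : Vector ℚ k) → x · const 0ℚ ≡ 0ℚ
·-zeroʳ {k} x = trans (sum-cong-≗ (*-zeroʳ ∘ x)) (sum-replicate-zero k)

x·δ≡x : ∀ {k} (x : Vector ℚ k) (j : Fin k) → x · (λ i → δ i j) ≡ x j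
x·δ≡x x j = trans (sum-cong-≗ (λ i → trans (*-comm (x i) (δ i j)) (cong (_* x i) (δ-comm i j)))) (δ·x≡x j x)

·-congʳ : ∀ {k} (a : Vector ℚ k) {x y : Vector ℚ k} → x ≗ y → a · x ≡ a · y
·-congʳ a x≗y = sum-cong-≗ (λ i → cong (a i *_) (x≗y i))

·-split : ∀ {m k} (a w : Vector ℚ (m ℕ.+ k)) →
          a · w ≡ (a ∘ (_↑ˡ k)) · (w ∘ (_↑ˡ k)) + (a ∘ (m ↑ʳ_)) · (w ∘ (m ↑ʳ_))
·-split {m} a w = sum-++ m (λ i → a i * w i)

·-comm : ∀ {k} (a x : Vector ℚ k) → a · x ≡ x · a
·-comm a x = sum-cong-≗ (λ i → *-comm (a i) (x i))

·-neg : ∀ {k} (a x : Vector ℚ k) → a · (λ i → - x i) ≡ - (a · x)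
·-neg a x = begin
  a · (λ i → - x i)             ≡⟨ sum-cong-≗ (λ i →
                                     solve 2 (λ a x → a :* (:- x) := (:- con 1ℚ :* a) :* x) refl (a i) (x i)) ⟩
  (λ i → - 1ℚ * a i) · x        ≡⟨ ·-assoc-* (- 1ℚ) a x ⟩
  - 1ℚ * (a · x)                ≡⟨ solve 1 (λ t → :- con 1ℚ :* t := :- t) refl (a · x) ⟩
  - (a · x)                     ∎
  where open ≡-Reasoning

++-split : ∀ {m k} (w : Vector ℚ (m ℕ.+ k)) → (w ∘ (_↑ˡ k)) ++ᵥ (w ∘ (m ↑ʳ_)) ≗ w
++-split {m} {k} w i = trans (sym ([,]-∘ w (splitAt m i))) (cong w (join-splitAt m k i))

·-∘-++ : ∀ {m k} {R : Set} (y : Vector ℚ (m ℕ.+ k)) (f : R → ℚ) (S : Vector R m) (E : Vector R k) →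
         y · (f ∘ (S ++ᵥ E)) ≡ (y ∘ (_↑ˡ k)) · (f ∘ S) + (y ∘ (m ↑ʳ_)) · (f ∘ E)
·-∘-++ {m} {k} y f S E = trans (·-split {m} y (f ∘ (S ++ᵥ E)))
  (cong₂ _+_ (·-congʳ (y ∘ (_↑ˡ k)) (cong f ∘ lookup-++ˡ S E))
             (·-congʳ (y ∘ (m ↑ʳ_)) (cong f ∘ lookup-++ʳ S E)))

++-nonNeg : ∀ {m k} {a : Vector ℚ m} {b : Vector ℚ k} →
            (∀ i → 0ℚ ≤ a i) → (∀ j → 0ℚ ≤ b j) → ∀ i → 0ℚ ≤ (a ++ᵥ b) i
++-nonNeg {m} 0≤a 0≤b i with splitAt m i
... | inj₁ i′ = 0≤a i′
... | inj₂ j  = 0≤b j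

·-nonPos : ∀ {k} {c w : Vector ℚ k} → (∀ i → c i ≤ 0ℚ) → (∀ i → 0ℚ ≤ w i) → c · w ≤ 0ℚ
·-nonPos {k} {c} {w} c≤0 0≤w = subst (c · w ≤_) (·-zeroˡ w) (sum-mono-≤ (λ i → *-monoʳ-≤-0≤ (0≤w i) (c≤0 i)))

++·++ : ∀ {m k} (a x : Vector ℚ m) (b z : Vector ℚ k) → (a ++ᵥ b) · (x ++ᵥ z) ≡ a · x + b · z
++·++ {m} a x b z = trans (·-split {m} (a ++ᵥ b) (x ++ᵥ z)) (cong₂ _+_
  (sum-cong-≗ (λ i → cong₂ _*_ (lookup-++ˡ a b i) (lookup-++ˡ x z i)))
  (sum-cong-≗ (λ j → cong₂ _*_ (lookup-++ʳ a b j) (lookup-++ʳ x z j))))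

keep : Bool → ℚ → ℚ
keep b q = if b then q else 0ℚ

mask : ∀ {k} → (Fin k → Bool) → Vector ℚ k → Vector ℚ k
mask e x v = keep (e v) (x v)

keep-nonNeg : ∀ b {q} → 0ℚ ≤ q → 0ℚ ≤ keep b q
keep-nonNeg true  0≤q = 0≤q
keep-nonNeg false 0≤q = ≤-refl

keep-* : ∀ b c q → keep b (c * q) ≡ c * keep b q
keep-* true  c q = refl
keep-* false c q = sym (*-zeroʳ c)

keep-swap : ∀ b p q → p * keep b q ≡ keep b p * q
keep-swap true  p q = refl
keep-swap false p q = trans (*-zeroʳ p) (sym (*-zeroˡ q))

keep-1 : ∀ b q → keep b 1ℚ * q ≡ keep b q
keep-1 true  q = *-identityˡ q
keep-1 false q = *-zeroˡ q

keep-0 : ∀ b → keep b 0ℚ ≡ 0ℚ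
keep-0 true  = refl
keep-0 false = refl

keep-not : ∀ b q → keep (not b) q + keep b q ≡ q
keep-not true  q = +-identityˡ q
keep-not false q = +-identityʳ q

sum-mask-not : ∀ {k} (e : Fin k → Bool) x → sum (mask (not ∘ e) x) ≡ sum x - sum (mask e x)
sum-mask-not e x = begin
  sum (mask (not ∘ e) x)                                 ≡⟨ solve 2 (λ a b → a := (a :+ b) :- b) refl _ _ ⟩
  sum (mask (not ∘ e) x) + sum (mask e x) - sum (mask e x)
    ≡⟨ cong (_- sum (mask e x)) (∑-distrib-+ (mask (not ∘ e) x) (mask e x)) ⟨
  sum (λ v → mask (not ∘ e) x v + mask e x v) - sum (mask e x)
    ≡⟨ cong (_- sum (mask e x)) (sum-cong-≗ (λ v → keep-not (e v) (x v))) ⟩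
  sum x - sum (mask e x)                                 ∎
  where open ≡-Reasoning

mask≤ : ∀ {k} (e : Fin k → Bool) {x : Vector ℚ k} → (∀ v → 0ℚ ≤ x v) → ∀ v → mask e x v ≤ x v
mask≤ e 0≤x v with e v
... | true  = ≤-refl
... | false = 0≤x v

mask1·x : ∀ {k} (e : Fin k → Bool) x → mask e (const 1ℚ) · x ≡ sum (mask e x)
mask1·x e x = sum-cong-≗ (λ v → keep-1 (e v) (x v))

sum-mask-zero : ∀ {k} (e : Fin k → Bool) → sum (mask e (const 0ℚ)) ≡ 0ℚ
sum-mask-zero {k} e = trans (sum-cong-≗ (keep-0 ∘ e)) (sum-replicate-zero k)

BoolMatrix : ℕ → Set
BoolMatrix n = Fin n → Fin n → Bool

_*ᵥ_ : ∀ {n} → BoolMatrix n → Vector ℚ n → Vector ℚ n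
(A *ᵥ x) v = sum (mask (A v) x)

_ᵥ*_ : ∀ {n} → Vector ℚ n → BoolMatrix n → Vector ℚ n
(y ᵥ* A) u = sum (mask (λ v → A v u) y)

·-*ᵥ : ∀ {n} (A : BoolMatrix n) (x y : Vector ℚ n) → y · (A *ᵥ x) ≡ (y ᵥ* A) · x
·-*ᵥ A x y = begin
  sum (λ v → y v * sum (mask (A v) x))
    ≡⟨ sum-cong-≗ (λ v → *-distribˡ-sum (y v) (mask (A v) x)) ⟩
  sum (λ v → sum (λ u → y v * keep (A v u) (x u)))
    ≡⟨ sum-cong-≗ (λ v → sum-cong-≗ (λ u → keep-swap (A v u) (y v) (x u))) ⟩
  sum (λ v → sum (λ u → keep (A v u) (y v) * x u))
    ≡⟨ ∑-comm (λ v u → keep (A v u) (y v) * x u) ⟩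
  sum (λ u → sum (λ v → keep (A v u) (y v) * x u))
    ≡⟨ sum-cong-≗ (λ u → *-distribʳ-sum (x u) (λ v → keep (A v u) (y v))) ⟨
  sum (λ u → (y ᵥ* A) u * x u)                     ∎
  where open ≡-Reasoning

weakDuality : ∀ {n} (A : BoolMatrix n) {x y : Vector ℚ n} {α β : ℚ} →
              (∀ u → 0ℚ ≤ x u) → (∀ v → 0ℚ ≤ y v) →
              (∀ v → α ≤ (A *ᵥ x) v) → (∀ u → (y ᵥ* A) u ≤ β) → α * sum y ≤ β * sum x
weakDuality A {x} {y} {α} {β} 0≤x 0≤y α≤Ax yA≤β = begin
  α * sum y                  ≡⟨ *-comm α (sum y) ⟩
  sum y * α                  ≡⟨ *-distribʳ-sum α y ⟩
  sum (λ v → y v * α)        ≤⟨ sum-mono-≤ (λ v → *-monoˡ-≤-0≤ (0≤y v) (α≤Ax v)) ⟩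
  y · (A *ᵥ x)               ≡⟨ ·-*ᵥ A x y ⟩
  (y ᵥ* A) · x               ≤⟨ sum-mono-≤ (λ u → *-monoʳ-≤-0≤ (0≤x u) (yA≤β u)) ⟩
  sum (λ u → β * x u)        ≡⟨ *-distribˡ-sum β x ⟨
  β * sum x                  ∎
  where open ≤-Reasoning

-- Linear inequalities and the Fourier–Motzkin form of Farkas' lemma

record Row (K : ℕ) : Set where
  constructor row
  field
    coef : Vector ℚ K
    rhs  : ℚ
open Row

infix 4 _⊨_ _≈ᵣ_
infixl 6 _⊕_
infixl 7 _⊙_

_⊨_ : ∀ {K} → Vector ℚ K → Row K → Set
x ⊨ r = rhs r ≤ coef r · x

_⊕_ : ∀ {K} → Row K → Row K → Row K
r ⊕ s = row (λ i → coef r i + coef s i) (rhs r + rhs s)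

_⊙_ : ∀ {K} → ℚ → Row K → Row K
c ⊙ r = row (λ i → c * coef r i) (c * rhs r)

_≈ᵣ_ : ∀ {K} → Row K → Row K → Set
r ≈ᵣ s = coef r ≗ coef s × rhs r ≡ rhs s

≈ᵣ-sym : ∀ {K} {r s : Row K} → r ≈ᵣ s → s ≈ᵣ r
≈ᵣ-sym (c≗ , b≡) = sym ∘ c≗ , sym b≡

≈ᵣ-trans : ∀ {K} {r s t : Row K} → r ≈ᵣ s → s ≈ᵣ t → r ≈ᵣ t
≈ᵣ-trans (c≗ , b≡) (c≗′ , b≡′) = (λ i → trans (c≗ i) (c≗′ i)) , trans b≡ b≡′

⊨-resp-≈ᵣ : ∀ {K} {x : Vector ℚ K} {r s} → r ≈ᵣ s → x ⊨ r → x ⊨ s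
⊨-resp-≈ᵣ {x = x} (c≗ , b≡) = subst₂ _≤_ b≡ (·-cong x c≗)

⊨-⊙⁻¹ : ∀ {K} {x : Vector ℚ K} {c r} → 0ℚ < c → x ⊨ c ⊙ r → x ⊨ r
⊨-⊙⁻¹ {x = x} {c} {r} 0<c x⊨cr =
  *-cancelˡ-≤-pos c {{positive 0<c}} (subst (c * rhs r ≤_) (·-assoc-* c (coef r) x) x⊨cr)

record IsCone {K} (G : Row K → Set) : Set where
  field
    ≈-resp   : ∀ {r s} → r ≈ᵣ s → G r → G s
    ⊕-closed : ∀ {r s} → G r → G s → G (r ⊕ s)
    ⊙-closed : ∀ {c r} → 0ℚ ≤ c → G r → G (c ⊙ r)
open IsCone

Solution : ∀ {K} → List (Row K) → Set
Solution {K} S = ∃ λ (x : Vector ℚ K) → All (x ⊨_) S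

ContainsAbsurd : ∀ {K} → (Row K → Set) → Set
ContainsAbsurd G = ∃ λ b → 0ℚ < b × G (row (const 0ℚ) b)

withHead : ∀ {K} → ℚ → Row K → Row (ℕ.suc K)
withHead c r = row (c ◂ coef r) (rhs r)

dropHead : ∀ {K} → Row (ℕ.suc K) → Row K
dropHead r = row (coef r ∘ suc) (rhs r)

withHead-dropHead : ∀ {K} (r : Row (ℕ.suc K)) {c} → coef r zero ≡ c → withHead c (dropHead r) ≈ᵣ r
withHead-dropHead r r₀≡c = (λ { zero → sym r₀≡c ; (suc i) → refl }) , refl

withHead0-isCone : ∀ {K} {G : Row (ℕ.suc K) → Set} → IsCone G → IsCone (G ∘ withHead 0ℚ)
withHead0-isCone cone = record
  { ≈-resp   = λ (c≗ , b≡) → ≈-resp cone ((λ { zero → refl ; (suc i) → c≗ i }) , b≡)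
  ; ⊕-closed = λ g h → ≈-resp cone ((λ { zero → +-identityˡ 0ℚ ; (suc i) → refl }) , refl) (⊕-closed cone g h)
  ; ⊙-closed = λ {c} 0≤c g → ≈-resp cone ((λ { zero → *-zeroʳ c ; (suc i) → refl }) , refl) (⊙-closed cone 0≤c g)
  }

data Normalisation (h : ℚ) : Set where
  pos  : ∀ c → 0ℚ < c → c * h ≡ 1ℚ → Normalisation h
  neg : ∀ c → 0ℚ < c → c * h ≡ - 1ℚ → Normalisation h
  nul      : h ≡ 0ℚ → Normalisation h

normalisation : ∀ h → Normalisation h
normalisation h with <-cmp h 0ℚ
... | tri≈ _ h≡0 _ = nul h≡0
... | tri> _ _ 0<h = pos ((1/ h) {{h≢0}}) (positive⁻¹ _ {{1/pos⇒pos h {{positive 0<h}}}})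
  (*-inverseˡ h {{h≢0}})
  where h≢0 = >-nonZero 0<h
... | tri< h<0 _ _ = neg ((1/ (- h)) {{neg-h≢0}}) (positive⁻¹ _ {{1/pos⇒pos (- h) {{positive 0<neg-h}}}})
  (trans (solve 2 (λ c h → c :* h := :- (c :* (:- h))) refl ((1/ (- h)) {{neg-h≢0}}) h)
         (cong -_ (*-inverseˡ (- h) {{neg-h≢0}})))
  where
  0<neg-h = neg-antimono-< h<0
  neg-h≢0 = >-nonZero 0<neg-h

-- After rescaling, a row of S says  x₀ ≥ …  (lowers),  x₀ ≤ …  (uppers), or does not involve x₀ (frees).
lowers uppers frees : ∀ {K} → List (Row (ℕ.suc K)) → List (Row K)
lowers [] = []
lowers (r ∷ S) with normalisation (coef r zero)
... | pos c _ _  = dropHead (c ⊙ r) ∷ lowers S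
... | neg _ _ _ = lowers S
... | nul _          = lowers S
uppers [] = []
uppers (r ∷ S) with normalisation (coef r zero)
... | pos _ _ _  = uppers S
... | neg c _ _ = dropHead (c ⊙ r) ∷ uppers S
... | nul _          = uppers S
frees [] = []
frees (r ∷ S) with normalisation (coef r zero)
... | pos _ _ _  = frees S
... | neg _ _ _ = frees S
... | nul _          = dropHead r ∷ frees S

partition-sound : ∀ {K} (x : Vector ℚ (ℕ.suc K)) S →
  All (λ p → x ⊨ withHead 1ℚ p) (lowers S) → All (λ q → x ⊨ withHead (- 1ℚ) q) (uppers S) →
  All (λ r → x ⊨ withHead 0ℚ r) (frees S) → All (x ⊨_) S
partition-sound x [] _ _ _ = []
partition-sound x (r ∷ S) ls us fs with normalisation (coef r zero)
partition-sound x (r ∷ S) (l ∷ ls) us fs | pos c 0<c ch≡1 =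
  ⊨-⊙⁻¹ {x = x} {r = r} 0<c (⊨-resp-≈ᵣ {x = x} (withHead-dropHead (c ⊙ r) ch≡1) l) ∷
  partition-sound x S ls us fs
partition-sound x (r ∷ S) ls (u ∷ us) fs | neg c 0<c ch≡-1 =
  ⊨-⊙⁻¹ {x = x} {r = r} 0<c (⊨-resp-≈ᵣ {x = x} (withHead-dropHead (c ⊙ r) ch≡-1) u) ∷
  partition-sound x S ls us fs
partition-sound x (r ∷ S) ls us (f ∷ fs) | nul h≡0 =
  ⊨-resp-≈ᵣ {x = x} (withHead-dropHead r h≡0) f ∷ partition-sound x S ls us fs

partition-cone : ∀ {K} {G : Row (ℕ.suc K) → Set} → IsCone G → ∀ {S} → All G S →
  All (G ∘ withHead 1ℚ) (lowers S) × All (G ∘ withHead (- 1ℚ)) (uppers S) × All (G ∘ withHead 0ℚ) (frees S)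
partition-cone cone [] = [] , [] , []
partition-cone cone {r ∷ S} (g ∷ gs) with normalisation (coef r zero) | partition-cone cone gs
... | pos c 0<c ch≡1 | ls , us , fs =
  ≈-resp cone (≈ᵣ-sym (withHead-dropHead (c ⊙ r) ch≡1)) (⊙-closed cone (<⇒≤ 0<c) g) ∷ ls , us , fs
... | neg c 0<c ch≡-1 | ls , us , fs =
  ls , ≈-resp cone (≈ᵣ-sym (withHead-dropHead (c ⊙ r) ch≡-1)) (⊙-closed cone (<⇒≤ 0<c) g) ∷ us , fs
... | nul h≡0 | ls , us , fs = ls , us , ≈-resp cone (≈ᵣ-sym (withHead-dropHead r h≡0)) g ∷ fs

All-cartesianProductWith⁺ : ∀ {A B C : Set} {P : A → Set} {Q : B → Set} {R : C → Set} (f : A → B → C) →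
  (∀ {a b} → P a → Q b → R (f a b)) → ∀ {as bs} → All P as → All Q bs → All R (cartesianProductWith f as bs)
All-cartesianProductWith⁺ f pres []       qs = []
All-cartesianProductWith⁺ f pres (p ∷ ps) qs =
  All.++⁺ (All.map⁺ (All.map (pres p) qs)) (All-cartesianProductWith⁺ f pres ps qs)

All-cartesianProductWith⁻ : ∀ {A B C : Set} {R : C → Set} (f : A → B → C) as bs →
  All R (cartesianProductWith f as bs) → All (λ a → All (λ b → R (f a b)) bs) as
All-cartesianProductWith⁻ f []       bs rs = []
All-cartesianProductWith⁻ f (a ∷ as) bs rs =
  All.map⁻ (All.++⁻ˡ (map (f a) bs) rs) ∷ All-cartesianProductWith⁻ f as bs (All.++⁻ʳ (map (f a) bs) rs)

projection : ∀ {K} → List (Row (ℕ.suc K)) → List (Row K)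
projection S = frees S ++ₗ cartesianProductWith _⊕_ (lowers S) (uppers S)

projection-cone : ∀ {K} {G : Row (ℕ.suc K) → Set} → IsCone G → ∀ {S} → All G S →
                  All (G ∘ withHead 0ℚ) (projection S)
projection-cone {G = G} cone gs = let ls , us , fs = partition-cone cone gs in
  All.++⁺ fs (All-cartesianProductWith⁺ _⊕_ cancel ls us)
  where
  cancel : ∀ {p q} → G (withHead 1ℚ p) → G (withHead (- 1ℚ) q) → G (withHead 0ℚ (p ⊕ q))
  cancel gp gq = ≈-resp cone ((λ { zero → +-inverseʳ 1ℚ ; (suc i) → refl }) , refl) (⊕-closed cone gp gq)

between : (ls us : List ℚ) → All (λ l → All (l ≤_) us) ls → ∃ λ x → All (_≤ x) ls × All (x ≤_) us
between ls us ls≤us =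
  min (max 0ℚ ls) us , All.zipWith (λ (l≤m , l≤us) → v≤min⁺ l≤m l≤us) (xs≤max 0ℚ ls , ls≤us) , min≤xs _ us

lowerBound upperBound : ∀ {K} → Vector ℚ K → Row K → ℚ
lowerBound x′ p = rhs p - coef p · x′
upperBound x′ q = coef q · x′ - rhs q

lowerBound≤upperBound : ∀ {K} (x′ : Vector ℚ K) p q → x′ ⊨ p ⊕ q → lowerBound x′ p ≤ upperBound x′ q
lowerBound≤upperBound x′ p q x′⊨p⊕q = ≤-resp-slack
  (solve 4 (λ a b s t → (s :+ t) :- (a :+ b) := (t :- b) :- (a :- s)) refl (rhs p) (rhs q) (coef p · x′) (coef q · x′))
  (subst (rhs p + rhs q ≤_) (·-distribʳ-+ (coef p) (coef q) x′) x′⊨p⊕q)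

extend-solution : ∀ {K} (S : List (Row (ℕ.suc K))) → Solution (projection S) → Solution S
extend-solution S (x′ , x′⊨) = x , partition-sound x S
  (All.map (λ {p} → ≤-resp-slack
     (solve 3 (λ b t x₀ → x₀ :- (b :- t) := (con 1ℚ :* x₀ :+ t) :- b) refl (rhs p) (coef p · x′) x₀))
     (All.map⁻ lower))
  (All.map (λ {q} → ≤-resp-slack
     (solve 3 (λ b t x₀ → (t :- b) :- x₀ := ((:- con 1ℚ) :* x₀ :+ t) :- b) refl (rhs q) (coef q · x′) x₀))
     (All.map⁻ upper))
  (All.map (λ {r} → subst (rhs r ≤_) (solve 2 (λ t x₀ → t := con 0ℚ :* x₀ :+ t) refl (coef r · x′) x₀))
     (All.++⁻ˡ (frees S) x′⊨))
  where
  x′⊨pairs = All-cartesianProductWith⁻ _⊕_ (lowers S) (uppers S) (All.++⁻ʳ (frees S) x′⊨)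
  bounds = between (map (lowerBound x′) (lowers S)) (map (upperBound x′) (uppers S))
    (All.map⁺ (All.map (λ {p} → All.map⁺ ∘ All.map (λ {q} → lowerBound≤upperBound x′ p q)) x′⊨pairs))
  x₀ = proj₁ bounds
  lower = proj₁ (proj₂ bounds)
  upper = proj₂ (proj₂ bounds)
  x = x₀ ◂ x′

farkas-cone : ∀ K (S : List (Row K)) {G : Row K → Set} → IsCone G → All G S → Solution S ⊎ ContainsAbsurd G
farkas-cone ℕ.zero [] cone [] = inj₁ ((λ ()) , [])
farkas-cone ℕ.zero (r ∷ S) cone (g ∷ gs) with 0ℚ <? rhs r | farkas-cone ℕ.zero S cone gs
... | yes 0<b | _                = inj₂ (rhs r , 0<b , ≈-resp cone ((λ ()) , refl) g)
... | no  _   | inj₂ absurd      = inj₂ absurd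
... | no  0≮b | inj₁ (x , x⊨S)  = inj₁ (x , ≮⇒≥ 0≮b ∷ x⊨S)
farkas-cone (ℕ.suc K) S cone gs
  with farkas-cone K (projection S) (withHead0-isCone cone) (projection-cone cone gs)
... | inj₁ solution       = inj₁ (extend-solution S solution)
... | inj₂ (b , 0<b , g) = inj₂ (b , 0<b , ≈-resp cone ((λ { zero → refl ; (suc i) → refl }) , refl) g)

combination : ∀ {m K} → Vector ℚ m → (Fin m → Row K) → Row K
combination y S = row (λ j → y · (λ i → coef (S i) j)) (y · (rhs ∘ S))

combination-· : ∀ {m K} (y : Vector ℚ m) (S : Fin m → Row K) w →
                coef (combination y S) · w ≡ y · (λ i → coef (S i) · w)
combination-· y S w = begin
  sum (λ j → sum (λ i → y i * coef (S i) j) * w j)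
    ≡⟨ sum-cong-≗ (λ j → *-distribʳ-sum (w j) (λ i → y i * coef (S i) j)) ⟩
  sum (λ j → sum (λ i → y i * coef (S i) j * w j))
    ≡⟨ ∑-comm (λ j i → y i * coef (S i) j * w j) ⟩
  sum (λ i → sum (λ j → y i * coef (S i) j * w j))
    ≡⟨ sum-cong-≗ (λ i → trans (sum-cong-≗ (λ j → *-assoc (y i) (coef (S i) j) (w j)))
                               (sym (*-distribˡ-sum (y i) (λ j → coef (S i) j * w j)))) ⟩
  sum (λ i → y i * (coef (S i) · w))                ∎
  where open ≡-Reasoning

InCone : ∀ {m K} → (Fin m → Row K) → Row K → Set
InCone S r = ∃ λ y → (∀ i → 0ℚ ≤ y i) × combination y S ≈ᵣ r

InCone-isCone : ∀ {m K} (S : Fin m → Row K) → IsCone (InCone S)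
InCone-isCone S = record
  { ≈-resp   = λ r≈s (y , 0≤y , y≈r) → y , 0≤y , ≈ᵣ-trans y≈r r≈s
  ; ⊕-closed = λ (y , 0≤y , y≈r) (y′ , 0≤y′ , y′≈s) →
      (λ i → y i + y′ i) , (λ i → +-mono-≤ (0≤y i) (0≤y′ i)) ,
      ≈ᵣ-trans ((λ j → ·-distribʳ-+ y y′ _) , ·-distribʳ-+ y y′ _)
               ((λ j → cong₂ _+_ (proj₁ y≈r j) (proj₁ y′≈s j)) , cong₂ _+_ (proj₂ y≈r) (proj₂ y′≈s))
  ; ⊙-closed = λ {c} 0≤c (y , 0≤y , y≈r) →
      (λ i → c * y i) , (λ i → 0≤p⇒0≤q⇒0≤p*q 0≤c (0≤y i)) ,
      ≈ᵣ-trans ((λ j → ·-assoc-* c y _) , ·-assoc-* c y _)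
               ((λ j → cong (c *_) (proj₁ y≈r j)) , cong (c *_) (proj₂ y≈r))
  }

row-InCone : ∀ {m K} (S : Fin m → Row K) i → InCone S (S i)
row-InCone S i = δ i , δ-nonNeg i , (λ j → δ·x≡x i (λ i → coef (S i) j)) , δ·x≡x i (rhs ∘ S)

farkas : ∀ {m K} (S : Fin m → Row K) →
  (∃ λ (x : Vector ℚ K) → ∀ i → x ⊨ S i) ⊎
  (∃ λ y → (∀ i → 0ℚ ≤ y i) × ∃ λ b → 0ℚ < b × combination y S ≈ᵣ row (const 0ℚ) b)
farkas {K = K} S with farkas-cone K (tabulate S) (InCone-isCone S) (All.tabulate⁺ (row-InCone S))
... | inj₁ (x , x⊨S)             = inj₁ (x , All.tabulate⁻ x⊨S)
... | inj₂ (b , 0<b , y , 0≤y , y≈) = inj₂ (y , 0≤y , b , 0<b , y≈)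

combination-++ : ∀ {m k K} (y : Vector ℚ (m ℕ.+ k)) (S : Fin m → Row K) (E : Fin k → Row K) →
  combination y (S ++ᵥ E) ≈ᵣ combination (y ∘ (_↑ˡ k)) S ⊕ combination (y ∘ (m ↑ʳ_)) E
combination-++ y S E =
  (λ j → ·-∘-++ y (λ r → coef r j) S E) , ·-∘-++ y rhs S E

unitRow : ∀ {K} → Fin K → Row K
unitRow j = row (δ j) 0ℚ

p+q≡0⇒0≤q⇒p≤0 : ∀ {p q} → p + q ≡ 0ℚ → 0ℚ ≤ q → p ≤ 0ℚ
p+q≡0⇒0≤q⇒p≤0 {p} p+q≡0 0≤q = subst₂ _≤_ (+-identityʳ p) p+q≡0 (+-monoʳ-≤ p 0≤q)

farkas-nonNeg : ∀ {m K} (S : Fin m → Row K) →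
  (∃ λ (x : Vector ℚ K) → (∀ j → 0ℚ ≤ x j) × ∀ i → x ⊨ S i) ⊎
  (∃ λ y → (∀ i → 0ℚ ≤ y i) × (∀ j → coef (combination y S) j ≤ 0ℚ) × 0ℚ < rhs (combination y S))
farkas-nonNeg {m} {K} S with farkas (S ++ᵥ unitRow)
... | inj₁ (x , x⊨) = inj₁ (x , 0≤x , x⊨S)
  where
  0≤x : ∀ j → 0ℚ ≤ x j
  0≤x j = subst (0ℚ ≤_) (δ·x≡x j x) (subst (x ⊨_) (lookup-++ʳ S unitRow j) (x⊨ (m ↑ʳ j)))
  x⊨S : ∀ i → x ⊨ S i
  x⊨S i = subst (x ⊨_) (lookup-++ˡ S unitRow i) (x⊨ (i ↑ˡ K))
... | inj₂ (y , 0≤y , b , 0<b , y≈) = inj₂ (y ∘ (_↑ˡ K) , 0≤y ∘ (_↑ˡ K) , coef≤0 , 0<rhs)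
  where
  yᵤ = y ∘ (m ↑ʳ_)
  c = combination (y ∘ (_↑ˡ K)) S
  split : c ⊕ combination yᵤ unitRow ≈ᵣ row (const 0ℚ) b
  split = ≈ᵣ-trans (≈ᵣ-sym (combination-++ y S unitRow)) y≈
  coef≤0 : ∀ j → coef c j ≤ 0ℚ
  coef≤0 j = p+q≡0⇒0≤q⇒p≤0 (trans (cong (coef c j +_) (sym (x·δ≡x yᵤ j))) (proj₁ split j)) (0≤y (m ↑ʳ j))
  0<rhs : 0ℚ < rhs c
  0<rhs = subst (0ℚ <_) (trans (sym (proj₂ split)) (trans (cong (rhs c +_) (·-zeroʳ yᵤ)) (+-identityʳ (rhs c)))) 0<b

-- Strong duality for covering linear programs

module CoveringDuality {n : ℕ} (A : BoolMatrix n) where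

  record PrimalDual : Set where
    field
      x z       : Vector ℚ n
      x-nonNeg  : ∀ u → 0ℚ ≤ x u
      x-covers  : ∀ v → 1ℚ ≤ (A *ᵥ x) v
      z-nonNeg  : ∀ v → 0ℚ ≤ z v
      z-packs   : ∀ u → (z ᵥ* A) u ≤ 1ℚ
      sum-x≡sum-z : sum x ≡ sum z

  -- Inequalities in the variables x ++ z: A x ≥ 1, z A ≤ 1 and Σ z ≥ Σ x.
  coverRow packingRow : Fin n → Row (n ℕ.+ n)
  coverRow v   = row (mask (A v) (const 1ℚ) ++ᵥ const 0ℚ) 1ℚ
  packingRow u = (- 1ℚ) ⊙ row (const 0ℚ ++ᵥ mask (λ v → A v u) (const 1ℚ)) 1ℚ

  objectiveRow : Row (n ℕ.+ n)
  objectiveRow = row (replicate n (- 1ℚ) ++ᵥ replicate n 1ℚ) 0ℚ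

  dualitySystem : Fin (n ℕ.+ (n ℕ.+ 1)) → Row (n ℕ.+ n)
  dualitySystem = coverRow ++ᵥ (packingRow ++ᵥ const objectiveRow)

  coverRow-· : ∀ v (x z : Vector ℚ n) → coef (coverRow v) · (x ++ᵥ z) ≡ (A *ᵥ x) v
  coverRow-· v x z = begin
    coef (coverRow v) · (x ++ᵥ z)               ≡⟨ ++·++ {n} {n} (mask (A v) (const 1ℚ)) x (const 0ℚ) z ⟩
    mask (A v) (const 1ℚ) · x + const 0ℚ · z    ≡⟨ cong₂ _+_ (mask1·x (A v) x) (·-zeroˡ z) ⟩
    (A *ᵥ x) v + 0ℚ                             ≡⟨ +-identityʳ ((A *ᵥ x) v) ⟩
    (A *ᵥ x) v                                  ∎
    where open ≡-Reasoning

  packingRow-· : ∀ u (x z : Vector ℚ n) → coef (packingRow u) · (x ++ᵥ z) ≡ - (z ᵥ* A) u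
  packingRow-· u x z = begin
    coef (packingRow u) · (x ++ᵥ z)            ≡⟨ ·-assoc-* (- 1ℚ) (const 0ℚ ++ᵥ column) (x ++ᵥ z) ⟩
    - 1ℚ * ((const 0ℚ ++ᵥ column) · (x ++ᵥ z)) ≡⟨ cong (- 1ℚ *_) (++·++ {n} {n} (const 0ℚ) x column z) ⟩
    - 1ℚ * (const 0ℚ · x + column · z)         ≡⟨ cong (λ t → - 1ℚ * (t + column · z)) (·-zeroˡ x) ⟩
    - 1ℚ * (0ℚ + column · z)                   ≡⟨ cong (λ t → - 1ℚ * (0ℚ + t)) (mask1·x (λ v → A v u) z) ⟩
    - 1ℚ * (0ℚ + (z ᵥ* A) u)                   ≡⟨ solve 1 (λ t → :- con 1ℚ :* (con 0ℚ :+ t) := :- t) refl _ ⟩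
    - (z ᵥ* A) u                               ∎
    where
    open ≡-Reasoning
    column = mask (λ v → A v u) (const 1ℚ)

  objectiveRow-· : ∀ (x z : Vector ℚ n) → coef objectiveRow · (x ++ᵥ z) ≡ sum z - sum x
  objectiveRow-· x z = trans (++·++ {n} {n} (const (- 1ℚ)) x (const 1ℚ) z)
    (trans (cong₂ _+_ (·-const (- 1ℚ) x) (·-const 1ℚ z))
           (solve 2 (λ a b → :- con 1ℚ :* a :+ con 1ℚ :* b := b :- a) refl (sum x) (sum z)))

  solution⇒primalDual : (w : Vector ℚ (n ℕ.+ n)) → (∀ j → 0ℚ ≤ w j) → (∀ i → w ⊨ dualitySystem i) →
                        PrimalDual
  solution⇒primalDual w 0≤w w⊨ = record
    { x = x ; z = z ; x-nonNeg = 0≤x ; x-covers = x-covers ; z-nonNeg = 0≤z ; z-packs = z-packs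
    ; sum-x≡sum-z = ≤-antisym Σx≤Σz Σz≤Σx }
    where
    x = w ∘ (_↑ˡ n)
    z = w ∘ (n ↑ʳ_)
    0≤x : ∀ u → 0ℚ ≤ x u
    0≤x = 0≤w ∘ (_↑ˡ n)
    0≤z : ∀ v → 0ℚ ≤ z v
    0≤z = 0≤w ∘ (n ↑ʳ_)
    holds : ∀ {i r} → dualitySystem i ≡ r → rhs r ≤ coef r · (x ++ᵥ z)
    holds {i} refl = subst (rhs (dualitySystem i) ≤_) (sym (·-congʳ (coef (dualitySystem i)) (++-split {n} w))) (w⊨ i)
    x-covers : ∀ v → 1ℚ ≤ (A *ᵥ x) v
    x-covers v = subst (1ℚ ≤_) (coverRow-· v x z) (holds (lookup-++ˡ coverRow _ v))
    z-packs : ∀ u → (z ᵥ* A) u ≤ 1ℚ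
    z-packs u = subst₂ _≤_ (-‿involutive _) (-‿involutive 1ℚ) (neg-antimono-≤
      (subst (- 1ℚ ≤_) (packingRow-· u x z)
        (holds (trans (lookup-++ʳ coverRow _ (u ↑ˡ 1)) (lookup-++ˡ packingRow _ u)))))
    Σx≤Σz : sum x ≤ sum z
    Σx≤Σz = 0≤q-p⇒p≤q (subst (0ℚ ≤_) (objectiveRow-· x z)
      (holds (trans (lookup-++ʳ coverRow _ (n ↑ʳ zero)) (lookup-++ʳ packingRow (const objectiveRow) zero))))
    Σz≤Σx : sum z ≤ sum x
    Σz≤Σx = subst₂ _≤_ (*-identityˡ (sum z)) (*-identityˡ (sum x)) (weakDuality A 0≤x 0≤z x-covers z-packs)

  module Certificate (y : Vector ℚ (n ℕ.+ (n ℕ.+ 1))) (0≤y : ∀ i → 0ℚ ≤ y i)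
                     (coef≤0 : ∀ j → coef (combination y dualitySystem) j ≤ 0ℚ) where

    y-cover y-pack : Vector ℚ n
    y-cover = y ∘ (_↑ˡ (n ℕ.+ 1))
    y-pack  = y ∘ (n ↑ʳ_) ∘ (_↑ˡ 1)

    y-objective : ℚ
    y-objective = y (n ↑ʳ (n ↑ʳ zero))

    gap : ℚ
    gap = sum y-cover - sum y-pack

    0≤y-cover : ∀ v → 0ℚ ≤ y-cover v
    0≤y-cover v = 0≤y _

    0≤y-pack : ∀ u → 0ℚ ≤ y-pack u
    0≤y-pack u = 0≤y _

    combination-value : ∀ (x z : Vector ℚ n) → coef (combination y dualitySystem) · (x ++ᵥ z) ≡
      y-cover · (A *ᵥ x) - y-pack · (z ᵥ* A) + y-objective * (sum z - sum x)
    combination-value x z = begin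
      coef (combination y dualitySystem) · w                  ≡⟨ combination-· y dualitySystem w ⟩
      y · (value ∘ dualitySystem)                             ≡⟨ ·-∘-++ y value coverRow _ ⟩
      y-cover · (value ∘ coverRow) + y′ · (value ∘ (packingRow ++ᵥ const objectiveRow))
        ≡⟨ cong (y-cover · (value ∘ coverRow) +_) (·-∘-++ y′ value packingRow (const objectiveRow)) ⟩
      y-cover · (value ∘ coverRow) + (y-pack · (value ∘ packingRow) + (y-objective * value objectiveRow + 0ℚ))
        ≡⟨ cong₂ (λ a b → a + (b + (y-objective * value objectiveRow + 0ℚ)))
             (·-congʳ y-cover (λ v → coverRow-· v x z))
             (trans (·-congʳ y-pack (λ u → packingRow-· u x z)) (·-neg y-pack (z ᵥ* A))) ⟩
      y-cover · (A *ᵥ x) + (- (y-pack · (z ᵥ* A)) + (y-objective * value objectiveRow + 0ℚ))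
        ≡⟨ cong (λ t → y-cover · (A *ᵥ x) + (- (y-pack · (z ᵥ* A)) + (y-objective * t + 0ℚ))) (objectiveRow-· x z) ⟩
      y-cover · (A *ᵥ x) + (- (y-pack · (z ᵥ* A)) + (y-objective * (sum z - sum x) + 0ℚ))
        ≡⟨ solve 3 (λ a b c → a :+ (:- b :+ (c :+ con 0ℚ)) := a :- b :+ c) refl
             (y-cover · (A *ᵥ x)) (y-pack · (z ᵥ* A)) (y-objective * (sum z - sum x)) ⟩
      y-cover · (A *ᵥ x) - y-pack · (z ᵥ* A) + y-objective * (sum z - sum x) ∎
      where
      open ≡-Reasoning
      w = x ++ᵥ z
      value = λ (r : Row (n ℕ.+ n)) → coef r · w
      y′ = y ∘ (n ↑ʳ_)

    combination-rhs : rhs (combination y dualitySystem) ≡ gap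
    combination-rhs = begin
      y · (rhs ∘ dualitySystem)                                     ≡⟨ ·-∘-++ y rhs coverRow _ ⟩
      y-cover · const 1ℚ + y′ · (rhs ∘ (packingRow ++ᵥ const objectiveRow))
        ≡⟨ cong (y-cover · const 1ℚ +_) (·-∘-++ y′ rhs packingRow (const objectiveRow)) ⟩
      y-cover · const 1ℚ + (y-pack · const (- 1ℚ * 1ℚ) + (y-objective * 0ℚ + 0ℚ))
        ≡⟨ cong₂ (λ a b → a + (b + (y-objective * 0ℚ + 0ℚ)))
             (trans (·-comm y-cover _) (·-const 1ℚ y-cover)) (trans (·-comm y-pack _) (·-const (- 1ℚ * 1ℚ) y-pack)) ⟩
      1ℚ * sum y-cover + ((- 1ℚ * 1ℚ) * sum y-pack + (y-objective * 0ℚ + 0ℚ))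
        ≡⟨ solve 3 (λ a b c → con 1ℚ :* a :+ ((:- con 1ℚ :* con 1ℚ) :* b :+ (c :* con 0ℚ :+ con 0ℚ)) := a :- b)
             refl (sum y-cover) (sum y-pack) y-objective ⟩
      gap ∎
      where
      open ≡-Reasoning
      y′ = y ∘ (n ↑ʳ_)

    combination-value≤0 : ∀ {x z} → (∀ u → 0ℚ ≤ x u) → (∀ v → 0ℚ ≤ z v) →
                          y-cover · (A *ᵥ x) - y-pack · (z ᵥ* A) + y-objective * (sum z - sum x) ≤ 0ℚ
    combination-value≤0 {x} {z} 0≤x 0≤z =
      subst (_≤ 0ℚ) (combination-value x z) (·-nonPos coef≤0 (++-nonNeg 0≤x 0≤z))

    -- At x = y-pack, z = y-cover the cover and packing terms cancel.
    0<y-objective⇒gap≤0 : 0ℚ < y-objective → gap ≤ 0ℚ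
    0<y-objective⇒gap≤0 0<μ = *-cancelˡ-≤-pos y-objective {{positive 0<μ}}
      (subst₂ _≤_ value≡μ*gap (sym (*-zeroʳ y-objective)) (combination-value≤0 0≤y-pack 0≤y-cover))
      where
      value≡μ*gap : y-cover · (A *ᵥ y-pack) - y-pack · (y-cover ᵥ* A) + y-objective * gap ≡ y-objective * gap
      value≡μ*gap = trans (cong (λ t → t - y-pack · (y-cover ᵥ* A) + y-objective * gap)
                                (trans (·-*ᵥ A y-pack y-cover) (·-comm (y-cover ᵥ* A) y-pack)))
                          (solve 2 (λ t m → t :- t :+ m := m) refl (y-pack · (y-cover ᵥ* A)) (y-objective * gap))

    y-objective≡0⇒gap≤0 : (∀ v → ∃ λ u → A v u ≡ true) → y-objective ≡ 0ℚ → gap ≤ 0ℚ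
    y-objective≡0⇒gap≤0 rows-nonEmpty μ≡0 = begin
      sum y-cover - sum y-pack       ≤⟨ ≤-resp-slack (solve 2 (λ a b → b :- con 0ℚ := a :- (a :- b)) refl
                                                      (sum y-cover) (sum y-pack)) (sum-nonNeg 0≤y-pack) ⟩
      sum y-cover                    ≤⟨ sum-mono-≤ (λ v → subst (_≤ y-cover v * (A *ᵥ ones) v) (*-identityʳ (y-cover v))
                                                              (*-monoˡ-≤-0≤ (0≤y-cover v) (1≤A·ones v))) ⟩
      y-cover · (A *ᵥ ones)          ≡⟨ value≡ ⟨
      y-cover · (A *ᵥ ones) - y-pack · (const 0ℚ ᵥ* A) + y-objective * (sum {n} (const 0ℚ) - sum ones)
                                     ≤⟨ combination-value≤0 {ones} {const 0ℚ} (λ _ → 0≤1) (λ _ → ≤-refl) ⟩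
      0ℚ                             ∎
      where
      open ≤-Reasoning
      ones = replicate n 1ℚ
      1≤A·ones : ∀ v → 1ℚ ≤ (A *ᵥ ones) v
      1≤A·ones v = let u , Avu≡true = rows-nonEmpty v in
        subst (λ b → keep b 1ℚ ≤ (A *ᵥ ones) v) Avu≡true (term≤sum (λ w → keep-nonNeg (A v w) 0≤1) u)
      value≡ : y-cover · (A *ᵥ ones) - y-pack · (const 0ℚ ᵥ* A) + y-objective * (sum {n} (const 0ℚ) - sum ones)
               ≡ y-cover · (A *ᵥ ones)
      value≡ = trans (cong₂ (λ a b → y-cover · (A *ᵥ ones) - a + b)
                       (trans (·-congʳ y-pack (sum-mask-zero ∘ λ u v → A v u)) (·-zeroʳ y-pack))
                       (trans (cong (_* (sum {n} (const 0ℚ) - sum ones)) μ≡0) (*-zeroˡ (sum {n} (const 0ℚ) - sum ones))))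
                     (solve 1 (λ t → t :- con 0ℚ :+ con 0ℚ := t) refl (y-cover · (A *ᵥ ones)))

  no-certificate : (∀ v → ∃ λ u → A v u ≡ true) → ∀ y → (∀ i → 0ℚ ≤ y i) →
    (∀ j → coef (combination y dualitySystem) j ≤ 0ℚ) → ¬ 0ℚ < rhs (combination y dualitySystem)
  no-certificate rows-nonEmpty y 0≤y coef≤0 0<rhs =
    <-irrefl refl (<-≤-trans (subst (0ℚ <_) combination-rhs 0<rhs) gap≤0)
    where
    open Certificate y 0≤y coef≤0
    gap≤0 : gap ≤ 0ℚ
    gap≤0 with 0ℚ <? y-objective
    ... | yes 0<μ = 0<y-objective⇒gap≤0 0<μ
    ... | no  0≮μ = y-objective≡0⇒gap≤0 rows-nonEmpty (≤-antisym (≮⇒≥ 0≮μ) (0≤y _))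

  strongDuality : (∀ v → ∃ λ u → A v u ≡ true) → PrimalDual
  strongDuality rows-nonEmpty with farkas-nonNeg dualitySystem
  ... | inj₁ (w , 0≤w , w⊨) = solution⇒primalDual w 0≤w w⊨
  ... | inj₂ (y , 0≤y , coef≤0 , 0<rhs) = ⊥-elim (no-certificate rows-nonEmpty y 0≤y coef≤0 0<rhs)

open CoveringDuality using (PrimalDual; strongDuality)
open PrimalDual

-- Optimal values of the two programs

hypergraphOf : ∀ {n} → (Fin n → Fin n → Bool) → Hypergraph n
hypergraphOf {n} E = record { m = n ; edge = E }

isTauF-intro : ∀ {n} (E : Fin n → Fin n → Bool) (x : Vector ℚ n) →
  (∀ v → 0ℚ ≤ x v) → (∀ j → 1ℚ ≤ sum (mask (E j) x)) →
  (∀ x′ → (∀ v → 0ℚ ≤ x′ v) → (∀ j → 1ℚ ≤ sum (mask (E j) x′)) → sum x ≤ sum x′) →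
  IsTauF (hypergraphOf E) (sum x)
isTauF-intro E x 0≤x x-covers minimal =
  (x , (0≤x , λ j → subst (1ℚ ≤_) (sym (sumFin≡sum (mask (E j) x))) (x-covers j)) , sumFin≡sum x) ,
  λ x′ (0≤x′ , x′-covers) → subst (sum x ≤_) (sym (sumFin≡sum x′))
    (minimal x′ 0≤x′ (λ j → subst (1ℚ ≤_) (sumFin≡sum (mask (E j) x′)) (x′-covers j)))

primal-isTauF : ∀ {n} (A : BoolMatrix n) (pd : PrimalDual A) → IsTauF (hypergraphOf A) (sum (x pd))
primal-isTauF A pd = isTauF-intro A (x pd) (x-nonNeg pd) (x-covers pd) λ x′ 0≤x′ x′-covers →
  subst₂ _≤_ (trans (*-identityˡ _) (sym (sum-x≡sum-z pd))) (*-identityˡ _)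
    (weakDuality A 0≤x′ (z-nonNeg pd) x′-covers (z-packs pd))

ᵥ*-scale : ∀ {n} (A : BoolMatrix n) c (z : Vector ℚ n) u → ((λ v → c * z v) ᵥ* A) u ≡ c * (z ᵥ* A) u
ᵥ*-scale A c z u = trans (sum-cong-≗ (λ v → keep-* (A v u) c (z v))) (sym (*-distribˡ-sum c (mask (λ v → A v u) z)))

complement-isTauF : ∀ {n} (A E : BoolMatrix n) → (∀ v u → E v u ≡ not (A u v)) → (pd : PrimalDual A) →
  ∀ c → 0ℚ ≤ c → c * (sum (x pd) - 1ℚ) ≡ 1ℚ → IsTauF (hypergraphOf E) (c * sum (x pd))
complement-isTauF A E E≡¬Aᵀ pd c 0≤c c[t-1]≡1 =
  subst (IsTauF (hypergraphOf E)) Σy≡ct (isTauF-intro E y 0≤y y-covers minimal)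
  where
  t = sum (x pd)
  y : Vector ℚ _
  y v = c * z pd v
  sum-mask-E : ∀ y′ v → sum (mask (E v) y′) ≡ sum y′ - (y′ ᵥ* A) v
  sum-mask-E y′ v = trans (sum-cong-≗ (λ u → cong (λ b → keep b (y′ u)) (E≡¬Aᵀ v u)))
                          (sum-mask-not (λ u → A u v) y′)
  Σy≡ct : sum y ≡ c * t
  Σy≡ct = trans (sym (*-distribˡ-sum c (z pd))) (cong (c *_) (sym (sum-x≡sum-z pd)))
  0≤y : ∀ v → 0ℚ ≤ y v
  0≤y v = 0≤p⇒0≤q⇒0≤p*q 0≤c (z-nonNeg pd v)
  y-covers : ∀ v → 1ℚ ≤ sum (mask (E v) y)
  y-covers v = subst₂ _≤_ c[t-1]≡1
    (sym (trans (sum-mask-E y v) (trans (cong₂ _-_ Σy≡ct (ᵥ*-scale A c (z pd) v))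
      (solve 3 (λ c t a → c :* t :- c :* a := c :* (t :- a)) refl c t ((z pd ᵥ* A) v)))))
    (*-monoˡ-≤-0≤ 0≤c (+-monoʳ-≤ t (neg-antimono-≤ (z-packs pd v))))
  minimal : ∀ y′ → (∀ v → 0ℚ ≤ y′ v) → (∀ v → 1ℚ ≤ sum (mask (E v) y′)) → sum y ≤ sum y′
  minimal y′ 0≤y′ y′-covers = subst₂ _≤_ (sym Σy≡ct) c[s[t-1]]≡s (*-monoˡ-≤-0≤ 0≤c t≤s[t-1])
    where
    s = sum y′
    y′A≤s-1 : ∀ u → (y′ ᵥ* A) u ≤ s - 1ℚ
    y′A≤s-1 u = ≤-resp-slack (solve 2 (λ a s → s :- a :- con 1ℚ := s :- con 1ℚ :- a) refl ((y′ ᵥ* A) u) s)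
      (subst (1ℚ ≤_) (sum-mask-E y′ u) (y′-covers u))
    t≤s[t-1] : t ≤ s * (t - 1ℚ)
    t≤s[t-1] = ≤-resp-slack
      (solve 2 (λ s t → (s :- con 1ℚ) :* t :- con 1ℚ :* s := s :* (t :- con 1ℚ) :- t) refl s t)
      (weakDuality A (x-nonNeg pd) 0≤y′ (x-covers pd) y′A≤s-1)
    c[s[t-1]]≡s : c * (s * (t - 1ℚ)) ≡ s
    c[s[t-1]]≡s = trans (solve 3 (λ c s d → c :* (s :* d) := s :* (c :* d)) refl c s (t - 1ℚ))
                        (trans (cong (s *_) c[t-1]≡1) (*-identityʳ s))

support⊆everyEdge : ∀ {n} (A : BoolMatrix n) {x : Vector ℚ n} →
  (∀ u → 0ℚ ≤ x u) → (∀ v → 1ℚ ≤ (A *ᵥ x) v) → sum x ≤ 1ℚ →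
  ∀ {u} → 0ℚ < x u → ∀ v → A v u ≡ true
support⊆everyEdge A {x} 0≤x x-covers Σx≤1 {u} 0<xᵤ v with A v u in Avu
... | true  = refl
... | false = ⊥-elim (<-irrefl refl (<-≤-trans 0<xᵤ xᵤ≤0))
  where
  xᵤ≤0 : x u ≤ 0ℚ
  xᵤ≤0 = begin
    x u                          ≡⟨ cong (λ b → keep (not b) (x u)) Avu ⟨
    mask (not ∘ A v) x u         ≤⟨ term≤sum (λ w → keep-nonNeg (not (A v w)) (0≤x w)) u ⟩
    sum (mask (not ∘ A v) x)     ≡⟨ sum-mask-not (A v) x ⟩
    sum x - (A *ᵥ x) v           ≤⟨ +-mono-≤ Σx≤1 (neg-antimono-≤ (x-covers v)) ⟩
    1ℚ - 1ℚ                      ≡⟨ +-inverseʳ 1ℚ ⟩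
    0ℚ                           ∎
    where open ≤-Reasoning

1<sum : ∀ {n} (A : BoolMatrix n) → Fin n → (∀ u → ¬ (∀ v → A v u ≡ true)) →
  ∀ {x} → (∀ u → 0ℚ ≤ x u) → (∀ v → 1ℚ ≤ (A *ᵥ x) v) → 1ℚ < sum x
1<sum A v₀ no-common {x} 0≤x x-covers with 1ℚ <? sum x
... | yes 1<Σx = 1<Σx
... | no  1≮Σx = ⊥-elim (no-common u (support⊆everyEdge A 0≤x x-covers (≮⇒≥ 1≮Σx) 0<xᵤ))
  where
  1≤Σx : 1ℚ ≤ sum x
  1≤Σx = ≤-trans (x-covers v₀) (sum-mono-≤ (mask≤ (A v₀) 0≤x))
  u,0<xᵤ = 0<sum⇒∃0<term x (<-≤-trans (positive⁻¹ 1ℚ) 1≤Σx)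
  u = proj₁ u,0<xᵤ
  0<xᵤ = proj₂ u,0<xᵤ

conjugateExponent : ∀ t → 1ℚ < t → Σ (0ℚ < t) λ 0<t → Σ ℚ λ c → 0ℚ ≤ c × c * (t - 1ℚ) ≡ 1ℚ ×
  Σ (0ℚ < c * t) λ 0<ct → (1/ t) {{>-nonZero 0<t}} + (1/ (c * t)) {{>-nonZero 0<ct}} ≡ 1ℚ
conjugateExponent t 1<t = 0<t , c , <⇒≤ 0<c , c[t-1]≡1 , 0<ct , sum≡1
  where
  0<t = <-trans (positive⁻¹ 1ℚ) 1<t
  0<t-1 = p<q⇒0<q-p 1<t
  t≢0 = >-nonZero 0<t
  t-1≢0 = >-nonZero 0<t-1
  c = (1/ (t - 1ℚ)) {{t-1≢0}}
  0<c : 0ℚ < c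
  0<c = positive⁻¹ c {{1/pos⇒pos (t - 1ℚ) {{positive 0<t-1}}}}
  c[t-1]≡1 : c * (t - 1ℚ) ≡ 1ℚ
  c[t-1]≡1 = *-inverseˡ (t - 1ℚ) {{t-1≢0}}
  0<ct : 0ℚ < c * t
  0<ct = positive⁻¹ (c * t) {{pos*pos⇒pos c {{positive 0<c}} t {{positive 0<t}}}}
  1/t = (1/ t) {{t≢0}}
  sum≡1 : 1/t + (1/ (c * t)) {{>-nonZero 0<ct}} ≡ 1ℚ
  sum≡1 = begin
    1/t + (1/ (c * t)) {{>-nonZero 0<ct}}    ≡⟨ cong (1/t +_) (1/-unique (c * t) ((t - 1ℚ) * 1/t) {{>-nonZero 0<ct}}
      (trans (solve 4 (λ c t d i → c :* t :* (d :* i) := (c :* d) :* (t :* i)) refl c t (t - 1ℚ) 1/t)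
             (cong₂ _*_ c[t-1]≡1 (*-inverseʳ t {{t≢0}})))) ⟩
    1/t + (t - 1ℚ) * 1/t                     ≡⟨ solve 2 (λ i t → i :+ (t :- con 1ℚ) :* i := t :* i) refl 1/t t ⟩
    t * 1/t                                  ≡⟨ *-inverseʳ t {{t≢0}} ⟩
    1ℚ                                       ∎
    where open ≡-Reasoning

not-∨ : ∀ a b → not (a ∨ b) ≡ not a ∧ not b
not-∨ true  b = refl
not-∨ false b = refl

inClosed-refl : ∀ (D : Digraph) v → inClosed D v v ≡ true
inClosed-refl D v =
  trans (cong (arc D v v ∨_) (trans (isYes≗does (v ≟ v)) (dec-true (v ≟ v) refl))) (∨-zeroʳ (arc D v v))

outOpen-complement : ∀ (D : Digraph) v u → outOpen (complement D) v u ≡ not (inClosed D u v)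
outOpen-complement D v u = sym (not-∨ (arc D v u) ⌊ v ≟ u ⌋)

nonZero⇒Fin : ∀ {m} → NonZero m → Fin m
nonZero⇒Fin {ℕ.zero}  nz = ⊥-elim (NonZero.nonZero nz)
nonZero⇒Fin {ℕ.suc m} _  = zero

theorem3 : (D : Digraph) → NonZero (n D) → Loopless D
    → (∀ (v : Fin (n D)) → ¬ InUniversal D v)
    → ∃₂ λ (t₁ t₂ : ℚ) → IsFracInDom D t₁ × IsFracTotalOutDom (complement D) t₂
    × Σ (0ℚ < t₁) λ p₁ → Σ (0ℚ < t₂) λ p₂ →
    (1/ t₁) {{>-nonZero p₁}} + (1/ t₂) {{>-nonZero p₂}} ≡ 1ℚ
theorem3 D nz _ no-in-universal =
  let pd = strongDuality A (λ v → v , inClosed-refl D v)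
      t  = sum (x pd)
      1<t = 1<sum A (nonZero⇒Fin nz) no-in-universal (x-nonNeg pd) (x-covers pd)
      0<t , c , 0≤c , c[t-1]≡1 , 0<ct , reciprocals = conjugateExponent t 1<t
  in t , c * t , primal-isTauF A pd ,
     complement-isTauF A (outOpen (complement D)) (outOpen-complement D) pd c 0≤c c[t-1]≡1 ,
     0<t , 0<ct , reciprocals
  where A = inClosed D
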